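{- Define $q_n(t)\in\mathbb Z[t]$ by $q_0=1$, $q_1=0$ and $q_{n+1}(t)=-2nt^2q_n(t)+4(t^3-1)q_n'(t)-n(n+11)\,t\,q_{n-1}(t)$ for $n\ge1$. Then for all $m\ge0$, $q_{3m}(0)\equiv1\bmod7$ if $m$ is even and $q_{3m}(0)\equiv6\bmod7$ if $m$ is odd. -}

module Defs where

open import Data.Nat using (ℕ; zero; suc)
open import Data.Integer using (ℤ; +_; -_) renaming (_+_ to _+ℤ_; _*_ to _*ℤ_)
open import Data.List using (List; []; _∷_)
open import Data.Product using (_×_; _,_; proj₁)

-- Polynomials in ℤ[t], represented as coefficient lists, lowest degree first:
-- a₀ ∷ a₁ ∷ … represents a₀ + a₁ t + … (trailing zeros are allowed).
Poly : Set
Poly = List ℤ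

_⊕_ : Poly → Poly → Poly
[] ⊕ q = q
(a ∷ p) ⊕ [] = a ∷ p
(a ∷ p) ⊕ (b ∷ q) = (a +ℤ b) ∷ (p ⊕ q)

_·_ : ℤ → Poly → Poly
c · [] = []
c · (a ∷ p) = (c *ℤ a) ∷ (c · p)

shift : ℕ → Poly → Poly
shift zero p = p
shift (suc k) p = + 0 ∷ shift k p

derivAux : ℕ → Poly → Poly
derivAux i [] = []
derivAux i (a ∷ p) = ((+ i) *ℤ a) ∷ derivAux (suc i) p

deriv : Poly → Poly
deriv [] = []
deriv (a ∷ p) = derivAux 1 p

eval0 : Poly → ℤ
eval0 [] = + 0
eval0 (a ∷ p) = a

step : ℕ → Poly → Poly → Poly
step n qn qn-1 =
  ((- (+ (2 Data.Nat.* n))) · shift 2 qn)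
  ⊕ (((+ 4) · shift 3 (deriv qn))
  ⊕ (((- (+ 4)) · deriv qn)
  ⊕ ((- (+ (n Data.Nat.* (n Data.Nat.+ 11)))) · shift 1 qn-1)))

-- pairs (q_{n+1}, q_n), starting from (q_1, q_0) = (0, 1)
qPair : ℕ → Poly × Poly
qPair zero = [] , (+ 1 ∷ [])
qPair (suc n) with qPair n
... | (qn+1 , qn) = step (suc n) qn+1 qn , qn+1

q : ℕ → Poly
q zero = + 1 ∷ []
q (suc n) = proj₁ (qPair n)

-- Modulo 7, the coefficients of t^j, j < 7, of q_{n+1} depend only on those of q_n and q_{n-1}:
-- the coefficient of t^7 of q_n enters q_n' only multiplied by 7, and n enters only through
-- n mod 7. So the pairs (q_{n+1}, q_n), truncated below t^7 and reduced mod 7, obey a recursion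
-- on a finite set driven by n mod 7. Running it, the pair returns to its initial value after 42
-- steps, and the constant terms at n = 3m, m < 14, alternate between 1 and 6.

module Submission where

open import Defs
open import Data.Nat using (ℕ; _*_; _+_)
open import Data.Integer using (+_; _-_)
open import Data.Integer.Divisibility using (_∣_)
open import Data.Product using (_×_)

open import Data.Nat as ℕ using (zero; suc; _∸_; _<_; _≤_; _<?_; s≤s; NonZero; _%_)
import Data.Nat.Properties as ℕ
open import Data.Nat.DivMod using ([m+kn]%n≡m%n)
open import Data.Nat.Induction using (<-rec)
import Data.Nat.Tactic.RingSolver as ℕ-Solver
open import Data.Integer as ℤ using (ℤ; -_) renaming (_+_ to _+ℤ_; _*_ to _*ℤ_)
import Data.Integer.Properties as ℤ
open import Data.Integer.DivMod using (_%ℕ_; _/ℕ_; a≡a%ℕn+[a/ℕn]*n)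
import Data.Integer.Divisibility.Signed as Signed
open import Data.Integer.Tactic.RingSolver using (solve-∀)
open import Data.List using (List; []; _∷_; map)
import Data.List.Properties as List
open import Data.Product using (_,_; proj₁; proj₂)
import Data.Product.Properties as Product
open import Data.Sum using (inj₁; inj₂)
open import Relation.Nullary using (yes; no)
open import Relation.Nullary.Decidable using (from-yes; _×-dec_)
open import Relation.Binary using (DecidableEquality)
open import Relation.Binary.PropositionalEquality
open import Function using (_∘_; _∘′_)

infix 4 _≡_mod_

record _≡_mod_ (a b : ℤ) (m : ℕ) : Set where
  constructor mod-divides
  field divides-difference : + m Signed.∣ (a - b)

open _≡_mod_

module _ {m : ℕ} where

  ≡-mod-refl : ∀ {a} → a ≡ a mod m
  ≡-mod-refl {a} = mod-divides (Signed.divides (+ 0) (ℤ.+-inverseʳ a))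

  ≡-mod-resp : ∀ {a a′ b b′} → a ≡ a′ → b ≡ b′ → a ≡ b mod m → a′ ≡ b′ mod m
  ≡-mod-resp refl refl a≡b = a≡b

  ≡-mod-trans : ∀ {a b c} → a ≡ b mod m → b ≡ c mod m → a ≡ c mod m
  ≡-mod-trans {a} {b} {c} (mod-divides m∣a-b) (mod-divides m∣b-c) =
    mod-divides (subst (+ m Signed.∣_) (telescope a b c) (Signed.∣m∣n⇒∣m+n m∣a-b m∣b-c))
    where
    telescope : ∀ a b c → (a - b) +ℤ (b - c) ≡ a - c
    telescope = solve-∀

  +-cong : ∀ {a a′ b b′} → a ≡ a′ mod m → b ≡ b′ mod m → a +ℤ b ≡ a′ +ℤ b′ mod m
  +-cong {a} {a′} {b} {b′} (mod-divides m∣a-a′) (mod-divides m∣b-b′) =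
    mod-divides (subst (+ m Signed.∣_) (regroup a a′ b b′) (Signed.∣m∣n⇒∣m+n m∣a-a′ m∣b-b′))
    where
    regroup : ∀ a a′ b b′ → (a - a′) +ℤ (b - b′) ≡ (a +ℤ b) - (a′ +ℤ b′)
    regroup = solve-∀

  *-cong : ∀ {a a′ b b′} → a ≡ a′ mod m → b ≡ b′ mod m → a *ℤ b ≡ a′ *ℤ b′ mod m
  *-cong {a} {a′} {b} {b′} (mod-divides m∣a-a′) (mod-divides m∣b-b′) =
    mod-divides (subst (+ m Signed.∣_) (split a a′ b b′)
      (Signed.∣m∣n⇒∣m+n (Signed.∣n⇒∣m*n a m∣b-b′) (Signed.∣m⇒∣m*n b′ m∣a-a′)))
    where
    split : ∀ a a′ b b′ → a *ℤ (b - b′) +ℤ (a - a′) *ℤ b′ ≡ a *ℤ b - a′ *ℤ b′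
    split = solve-∀

  neg-cong : ∀ {a a′} → a ≡ a′ mod m → - a ≡ - a′ mod m
  neg-cong {a} {a′} (mod-divides m∣a-a′) =
    mod-divides (subst (+ m Signed.∣_) (negate a a′) (Signed.∣m⇒∣-m m∣a-a′))
    where
    negate : ∀ a a′ → - (a - a′) ≡ - a - - a′
    negate = solve-∀

  m*a≡m*b : ∀ a b → + m *ℤ a ≡ + m *ℤ b mod m
  m*a≡m*b a b = mod-divides (Signed.divides (a - b) (factor a b (+ m)))
    where
    factor : ∀ a b m → m *ℤ a - m *ℤ b ≡ (a - b) *ℤ m
    factor = solve-∀

  a≡a%ℕm : .{{_ : NonZero m}} → ∀ a → a ≡ + (a %ℕ m) mod m
  a≡a%ℕm a = mod-divides (Signed.divides (a /ℕ m) (cancel (+ (a %ℕ m)) (a /ℕ m) (a≡a%ℕn+[a/ℕn]*n a m)))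
    where
    cancel : ∀ r q → a ≡ r +ℤ q *ℤ + m → a - r ≡ q *ℤ + m
    cancel r q a≡r+qm = trans (cong (_- r) a≡r+qm) (cancel-left r q (+ m))
      where
      cancel-left : ∀ r q m → r +ℤ q *ℤ m - r ≡ q *ℤ m
      cancel-left = solve-∀

  pos-*-cong : ∀ {a a′ b b′} → + a ≡ + a′ mod m → + b ≡ + b′ mod m → + (a * b) ≡ + (a′ * b′) mod m
  pos-*-cong {a} {a′} {b} {b′} a≡a′ b≡b′ =
    ≡-mod-resp (sym (ℤ.pos-* a b)) (sym (ℤ.pos-* a′ b′)) (*-cong a≡a′ b≡b′)

  pos-+-cong : ∀ {a a′ b b′} → + a ≡ + a′ mod m → + b ≡ + b′ mod m → + (a + b) ≡ + (a′ + b′) mod m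
  pos-+-cong {a} {a′} {b} {b′} a≡a′ b≡b′ =
    ≡-mod-resp (sym (ℤ.pos-+ a b)) (sym (ℤ.pos-+ a′ b′)) (+-cong a≡a′ b≡b′)

  ≡-mod⇒∣ : ∀ {a b} → a ≡ b mod m → + m ∣ (a - b)
  ≡-mod⇒∣ = Signed.∣⇒∣ᵤ ∘′ divides-difference

coef : ℕ → Poly → ℤ
coef j       []      = + 0
coef zero    (a ∷ p) = a
coef (suc j) (a ∷ p) = coef j p

eval0≡coef0 : ∀ p → eval0 p ≡ coef 0 p
eval0≡coef0 []      = refl
eval0≡coef0 (a ∷ p) = refl

coef-⊕ : ∀ j p r → coef j (p ⊕ r) ≡ coef j p +ℤ coef j r
coef-⊕ j       []      r       = sym (ℤ.+-identityˡ (coef j r))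
coef-⊕ j       (a ∷ p) []      = sym (ℤ.+-identityʳ (coef j (a ∷ p)))
coef-⊕ zero    (a ∷ p) (b ∷ r) = refl
coef-⊕ (suc j) (a ∷ p) (b ∷ r) = coef-⊕ j p r

coef-· : ∀ j c p → coef j (c · p) ≡ c *ℤ coef j p
coef-· j       c []      = sym (ℤ.*-zeroʳ c)
coef-· zero    c (a ∷ p) = refl
coef-· (suc j) c (a ∷ p) = coef-· j c p

coef-derivAux : ∀ i j p → coef j (derivAux i p) ≡ + (i + j) *ℤ coef j p
coef-derivAux i j       []      = sym (ℤ.*-zeroʳ (+ (i + j)))
coef-derivAux i zero    (a ∷ p) = cong (λ k → + k *ℤ a) (sym (ℕ.+-identityʳ i))
coef-derivAux i (suc j) (a ∷ p) =
  trans (coef-derivAux (suc i) j p) (cong (λ k → + k *ℤ coef j p) (sym (ℕ.+-suc i j)))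

coef-deriv : ∀ j p → coef j (deriv p) ≡ + (suc j) *ℤ coef (suc j) p
coef-deriv j []      = sym (ℤ.*-zeroʳ (+ (suc j)))
coef-deriv j (a ∷ p) = coef-derivAux 1 j p

record CongBelow (m d : ℕ) (p r : Poly) : Set where
  constructor congBelow
  field congruent : ∀ {j} → j < d → coef j p ≡ coef j r mod m

open CongBelow

module _ {m d : ℕ} where

  CongBelow-trans : ∀ {p r s} → CongBelow m d p r → CongBelow m d r s → CongBelow m d p s
  CongBelow-trans p≈r r≈s = congBelow λ j<d → ≡-mod-trans (congruent p≈r j<d) (congruent r≈s j<d)

  ⊕-congBelow : ∀ {p p′ r r′} → CongBelow m d p p′ → CongBelow m d r r′ →
                CongBelow m d (p ⊕ r) (p′ ⊕ r′)
  ⊕-congBelow {p} {p′} {r} {r′} p≈p′ r≈r′ = congBelow λ {j} j<d →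
    ≡-mod-resp (sym (coef-⊕ j p r)) (sym (coef-⊕ j p′ r′))
      (+-cong (congruent p≈p′ j<d) (congruent r≈r′ j<d))

  ·-congBelow : ∀ {c c′ p p′} → c ≡ c′ mod m → CongBelow m d p p′ →
                CongBelow m d (c · p) (c′ · p′)
  ·-congBelow {c} {c′} {p} {p′} c≡c′ p≈p′ = congBelow λ {j} j<d →
    ≡-mod-resp (sym (coef-· j c p)) (sym (coef-· j c′ p′)) (*-cong c≡c′ (congruent p≈p′ j<d))

  shift-congBelow : ∀ k {p p′} → CongBelow m d p p′ → CongBelow m d (shift k p) (shift k p′)
  shift-congBelow zero    p≈p′ = p≈p′
  shift-congBelow (suc k) p≈p′ = congBelow (coef-shift (shift-congBelow k p≈p′))
    where
    coef-shift : ∀ {r r′} → CongBelow m d r r′ → ∀ {j} → j < d → coef j (+ 0 ∷ r) ≡ coef j (+ 0 ∷ r′) mod m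
    coef-shift r≈r′ {zero}  _   = ≡-mod-refl
    coef-shift r≈r′ {suc j} j<d = congruent r≈r′ (ℕ.<⇒≤ j<d)

-- In degree m - 1 the derivative brings down the factor m, so both sides vanish modulo m.
deriv-congBelow : ∀ {m p p′} → CongBelow m m p p′ → CongBelow m m (deriv p) (deriv p′)
deriv-congBelow {m} {p} {p′} p≈p′ = congBelow λ {j} j<m →
  ≡-mod-resp (sym (coef-deriv j p)) (sym (coef-deriv j p′)) (scaled j<m)
  where
  scaled : ∀ {j} → j < m → + (suc j) *ℤ coef (suc j) p ≡ + (suc j) *ℤ coef (suc j) p′ mod m
  scaled {j} j<m with ℕ.m≤n⇒m<n∨m≡n j<m
  ... | inj₁ 1+j<m = *-cong (≡-mod-refl {a = + suc j}) (congruent p≈p′ 1+j<m)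
  ... | inj₂ refl  = m*a≡m*b (coef (suc j) p) (coef (suc j) p′)

step-congBelow : ∀ {m n n′ a a′ b b′} → + n ≡ + n′ mod m →
                 CongBelow m m a a′ → CongBelow m m b b′ →
                 CongBelow m m (step n a b) (step n′ a′ b′)
step-congBelow n≡n′ a≈a′ b≈b′ =
  ⊕-congBelow (·-congBelow (neg-cong (pos-*-cong (≡-mod-refl {a = + 2}) n≡n′)) (shift-congBelow 2 a≈a′))
  (⊕-congBelow (·-congBelow ≡-mod-refl (shift-congBelow 3 (deriv-congBelow a≈a′)))
  (⊕-congBelow (·-congBelow ≡-mod-refl (deriv-congBelow a≈a′))
               (·-congBelow (neg-cong (pos-*-cong n≡n′ (pos-+-cong n≡n′ (≡-mod-refl {a = + 11}))))
                            (shift-congBelow 1 b≈b′))))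

reduce : (m : ℕ) .{{_ : NonZero m}} → ℕ → Poly → Poly
reduce m zero    p       = []
reduce m (suc d) []      = + 0 ∷ reduce m d []
reduce m (suc d) (a ∷ p) = + (a %ℕ m) ∷ reduce m d p

reduce-congBelow : ∀ {m} .{{_ : NonZero m}} d p → CongBelow m d p (reduce m d p)
reduce-congBelow {m} d p = congBelow (coef-reduce d p)
  where
  coef-reduce : ∀ d p {j} → j < d → coef j p ≡ coef j (reduce m d p) mod m
  coef-reduce (suc d) []      {zero}  _   = ≡-mod-refl
  coef-reduce (suc d) []      {suc j} j<d = coef-reduce d [] (ℕ.≤-pred j<d)
  coef-reduce (suc d) (a ∷ p) {zero}  _   = a≡a%ℕm a
  coef-reduce (suc d) (a ∷ p) {suc j} j<d = coef-reduce d p (ℕ.≤-pred j<d)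

State : Set
State = Poly × Poly

StateCong : ℕ → State → State → Set
StateCong m (a , b) (a′ , b′) = CongBelow m m a a′ × CongBelow m m b b′

reducedStep : (m : ℕ) .{{_ : NonZero m}} → ℕ → State → State
reducedStep m r (a , b) = reduce m m (step r a b) , a

reducedPair : (m : ℕ) .{{_ : NonZero m}} → ℕ → State
reducedPair m zero    = reduce m m (proj₁ (qPair 0)) , reduce m m (proj₂ (qPair 0))
reducedPair m (suc n) = reducedStep m (suc n % m) (reducedPair m n)

-- advance m i k s performs steps i + 1, …, i + k, starting from the state s after step i.
advance : (m : ℕ) .{{_ : NonZero m}} → ℕ → ℕ → State → State
advance m i zero    s = s
advance m i (suc k) s = reducedStep m (suc (k + i) % m) (advance m i k s)

module _ (m : ℕ) .{{_ : NonZero m}} where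

  qPair≈reducedPair : ∀ n → StateCong m (qPair n) (reducedPair m n)
  qPair≈reducedPair zero    = reduce-congBelow m _ , reduce-congBelow m _
  qPair≈reducedPair (suc n) with qPair≈reducedPair n
  ... | a≈ , b≈ =
    CongBelow-trans (step-congBelow (a≡a%ℕm (+ suc n)) a≈ b≈) (reduce-congBelow m _) , a≈

  reducedPair-advance : ∀ k i → reducedPair m (k + i) ≡ advance m i k (reducedPair m i)
  reducedPair-advance zero    i = refl
  reducedPair-advance (suc k) i = cong (reducedStep m (suc (k + i) % m)) (reducedPair-advance k i)

  reducedPair-periodic : ∀ k → reducedPair m (k * m) ≡ reducedPair m 0 →
                         ∀ n → reducedPair m (n + k * m) ≡ reducedPair m n
  reducedPair-periodic k returns zero    = returns
  reducedPair-periodic k returns (suc n) =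
    cong₂ (reducedStep m) ([m+kn]%n≡m%n (suc n) k m) (reducedPair-periodic k returns n)

periodic-induction : ∀ {P : ℕ → Set} p .{{_ : NonZero p}} →
                     (∀ {k} → k < p → P k) → (∀ k → P k → P (k + p)) → ∀ k → P k
periodic-induction {P} p below shift-by-p = <-rec P induct
  where
  induct : ∀ k → (∀ {j} → j < k → P j) → P k
  induct k smaller with k <? p
  ... | yes k<p = below k<p
  ... | no  k≮p = subst P (ℕ.m∸n+n≡m p≤k)
                    (shift-by-p (k ∸ p) (smaller (ℕ.∸-monoʳ-< (ℕ.>-nonZero⁻¹ p) p≤k)))
    where p≤k = ℕ.≮⇒≥ k≮p

natPoly : List ℕ → Poly
natPoly = map (λ n → + n)

-- The reduced states after 6 k steps, k < 7, found by running the recursion; after 42 steps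
-- the recursion is back at its initial state, which the catch-all clause records.
checkpoint : ℕ → State
checkpoint 0 = natPoly (0 ∷ 0 ∷ 0 ∷ 0 ∷ 0 ∷ 0 ∷ 0 ∷ []) , natPoly (1 ∷ 0 ∷ 0 ∷ 0 ∷ 0 ∷ 0 ∷ 0 ∷ [])
checkpoint 1 = natPoly (0 ∷ 0 ∷ 5 ∷ 0 ∷ 0 ∷ 0 ∷ 0 ∷ []) , natPoly (1 ∷ 0 ∷ 0 ∷ 1 ∷ 0 ∷ 0 ∷ 0 ∷ [])
checkpoint 2 = natPoly (0 ∷ 0 ∷ 1 ∷ 0 ∷ 0 ∷ 2 ∷ 0 ∷ []) , natPoly (1 ∷ 0 ∷ 0 ∷ 6 ∷ 0 ∷ 0 ∷ 4 ∷ [])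
checkpoint 3 = natPoly (0 ∷ 0 ∷ 2 ∷ 0 ∷ 0 ∷ 2 ∷ 0 ∷ []) , natPoly (1 ∷ 0 ∷ 0 ∷ 1 ∷ 0 ∷ 0 ∷ 1 ∷ [])
checkpoint 4 = natPoly (0 ∷ 0 ∷ 1 ∷ 0 ∷ 0 ∷ 0 ∷ 0 ∷ []) , natPoly (1 ∷ 0 ∷ 0 ∷ 0 ∷ 0 ∷ 0 ∷ 0 ∷ [])
checkpoint 5 = natPoly (0 ∷ 0 ∷ 5 ∷ 0 ∷ 0 ∷ 0 ∷ 0 ∷ []) , natPoly (1 ∷ 0 ∷ 0 ∷ 3 ∷ 0 ∷ 0 ∷ 0 ∷ [])
checkpoint 6 = natPoly (0 ∷ 0 ∷ 0 ∷ 0 ∷ 0 ∷ 3 ∷ 0 ∷ []) , natPoly (1 ∷ 0 ∷ 0 ∷ 3 ∷ 0 ∷ 0 ∷ 3 ∷ [])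
checkpoint _ = checkpoint 0

_≟-State_ : DecidableEquality State
_≟-State_ = Product.≡-dec (List.≡-dec ℤ._≟_) (List.≡-dec ℤ._≟_)

advance-checkpoint : ∀ {k} → k < 7 → advance 7 (6 * k) 6 (checkpoint k) ≡ checkpoint (suc k)
advance-checkpoint = from-yes (ℕ.allUpTo? (λ k → advance 7 (6 * k) 6 (checkpoint k) ≟-State checkpoint (suc k)) 7)

checkpoint-residues : ∀ {k} → k < 7 →
                      (coef 0 (proj₂ (checkpoint k)) ≡ + 1) ×
                      (coef 0 (proj₂ (advance 7 (6 * k) 3 (checkpoint k))) ≡ + 6)
checkpoint-residues = from-yes (ℕ.allUpTo? (λ k →
  (coef 0 (proj₂ (checkpoint k)) ℤ.≟ + 1) ×-dec
  (coef 0 (proj₂ (advance 7 (6 * k) 3 (checkpoint k))) ℤ.≟ + 6)) 7)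

reducedPair-checkpoint : ∀ {k} → k ≤ 7 → reducedPair 7 (6 * k) ≡ checkpoint k
reducedPair-checkpoint {zero}  _     = refl
reducedPair-checkpoint {suc k} 1+k≤7 = begin
  reducedPair 7 (6 * suc k)
    ≡⟨ cong (reducedPair 7) (ℕ.*-suc 6 k) ⟩
  reducedPair 7 (6 + 6 * k)
    ≡⟨ reducedPair-advance 7 6 (6 * k) ⟩
  advance 7 (6 * k) 6 (reducedPair 7 (6 * k))
    ≡⟨ cong (advance 7 (6 * k) 6) (reducedPair-checkpoint (ℕ.<⇒≤ 1+k≤7)) ⟩
  advance 7 (6 * k) 6 (checkpoint k)
    ≡⟨ advance-checkpoint 1+k≤7 ⟩
  checkpoint (suc k)
    ∎
  where open ≡-Reasoning

constantResidue : ℕ → ℤ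
constantResidue n = coef 0 (proj₂ (reducedPair 7 n))

q-constant-term : ∀ n → eval0 (q n) ≡ constantResidue n mod 7
q-constant-term n = ≡-mod-resp (sym (trans (eval0≡coef0 (q n)) (cong (coef 0) (q≡proj₂qPair n)))) refl
                      (congruent (proj₂ (qPair≈reducedPair 7 n)) (s≤s ℕ.z≤n))
  where
  q≡proj₂qPair : ∀ n → q n ≡ proj₂ (qPair n)
  q≡proj₂qPair zero    = refl
  q≡proj₂qPair (suc n) = refl

Residues : ℕ → Set
Residues k = (constantResidue (3 * (2 * k)) ≡ + 1) × (constantResidue (3 * (2 * k + 1)) ≡ + 6)

residues-below-period : ∀ {k} → k < 7 → Residues k
residues-below-period {k} k<7 = at-even , at-odd
  where
  open ≡-Reasoning
  reached : reducedPair 7 (6 * k) ≡ checkpoint k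
  reached = reducedPair-checkpoint (ℕ.<⇒≤ k<7)
  odd-index : ∀ k → 3 * (2 * k + 1) ≡ 3 + 6 * k
  odd-index = ℕ-Solver.solve-∀
  at-even : constantResidue (3 * (2 * k)) ≡ + 1
  at-even = begin
    constantResidue (3 * (2 * k))  ≡⟨ cong constantResidue (sym (ℕ.*-assoc 3 2 k)) ⟩
    constantResidue (6 * k)        ≡⟨ cong (coef 0 ∘ proj₂) reached ⟩
    coef 0 (proj₂ (checkpoint k))  ≡⟨ proj₁ (checkpoint-residues k<7) ⟩
    + 1                            ∎
  at-odd : constantResidue (3 * (2 * k + 1)) ≡ + 6
  at-odd = begin
    constantResidue (3 * (2 * k + 1))
      ≡⟨ cong constantResidue (odd-index k) ⟩
    constantResidue (3 + 6 * k)
      ≡⟨ cong (coef 0 ∘ proj₂) (reducedPair-advance 7 3 (6 * k)) ⟩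
    coef 0 (proj₂ (advance 7 (6 * k) 3 (reducedPair 7 (6 * k))))
      ≡⟨ cong (λ s → coef 0 (proj₂ (advance 7 (6 * k) 3 s))) reached ⟩
    coef 0 (proj₂ (advance 7 (6 * k) 3 (checkpoint k)))
      ≡⟨ proj₂ (checkpoint-residues k<7) ⟩
    + 6
      ∎

reducedPair-returns : reducedPair 7 (6 * 7) ≡ reducedPair 7 0
reducedPair-returns = reducedPair-checkpoint {7} ℕ.≤-refl

constantResidue-periodic : ∀ n → constantResidue (n + 6 * 7) ≡ constantResidue n
constantResidue-periodic n = cong (coef 0 ∘ proj₂) (reducedPair-periodic 7 6 reducedPair-returns n)

constant-residues : ∀ k → Residues k
constant-residues = periodic-induction {P = Residues} 7 residues-below-period shift-by-period
  where
  even-shift : ∀ k → 3 * (2 * (k + 7)) ≡ 3 * (2 * k) + 6 * 7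
  even-shift = ℕ-Solver.solve-∀
  odd-shift : ∀ k → 3 * (2 * (k + 7) + 1) ≡ 3 * (2 * k + 1) + 6 * 7
  odd-shift = ℕ-Solver.solve-∀
  shift-by-period : ∀ k → Residues k → Residues (k + 7)
  shift-by-period k (even , odd) =
    trans (cong constantResidue (even-shift k)) (trans (constantResidue-periodic (3 * (2 * k))) even) ,
    trans (cong constantResidue (odd-shift k)) (trans (constantResidue-periodic (3 * (2 * k + 1))) odd)

q-divisibility : ∀ n {c} → constantResidue n ≡ c → + 7 ∣ (eval0 (q n) - c)
q-divisibility n {c} residue≡c =
  ≡-mod⇒∣ {a = eval0 (q n)} {b = c} (≡-mod-resp refl residue≡c (q-constant-term n))

proposition5p2 : (k : ℕ) → ((+ 7) ∣ (eval0 (q (3 * (2 * k))) - + 1)) × ((+ 7) ∣ (eval0 (q (3 * (2 * k + 1))) - + 6))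
proposition5p2 k =
  q-divisibility (3 * (2 * k)) (proj₁ (constant-residues k)) ,
  q-divisibility (3 * (2 * k + 1)) (proj₂ (constant-residues k))
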